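{- Let $v$ and $w$ be values, $E$ a term and $x$ a $\lambda$-variable. If $v\equiv w$ then $E[x:=v]\equiv E[x:=w]$.
   Context: Fix pairwise disjoint countably infinite sets of $\lambda$-variables ($x,y,\dots$), stack variables ($\alpha,\beta,\dots$), term variables ($a,b,\dots$), and countable sets of labels $l$ and constructors $C$. Values, terms, stacks, processes: $v,w::=x\mid\lambda x\,t\mid C[v]\mid\{l_i=v_i\}_{i\in I}$; $t,u::=a\mid v\mid t\,u\mid\mu\alpha\,t\mid p\mid v.l\mid\mathrm{case}_v[C_i[x_i]\to t_i]_{i\in I}\mid\delta_{v,w}$; $\pi::=\alpha\mid v.\pi\mid[t]\pi$; $p::=t\ast\pi$; $I$ finite; $\lambda x$, $\mu\alpha$ and the $x_i$ in case branches are binders, term variables are never bound. Substitutions map $\lambda$-variables to values, stack variables to stacks, term variables to terms (capture-avoiding). $\succ$ is the smallest relation on processes with: $t\,u\ast\pi\succ u\ast[t]\pi$; $v\ast[t]\pi\succ t\ast v.\pi$; $\lambda x\,t\ast v.\pi\succ t[x:=v]\ast\pi$; $\mu\alpha\,t\ast\pi\succ t[\alpha:=\pi]\ast\pi$; $p\ast\pi\succ p$; $\{l_i=v_i\}_{i\in I}.l_k\ast\pi\succ v_k\ast\pi$ ($k\in I$); $\mathrm{case}_{C_k[v]}[C_i[x_i]\to t_i]_{i\in I}\ast\pi\succ t_k[x_k:=v]\ast\pi$ ($k\in I$). A process is final if it is $v\ast\alpha$ with $v$ a value and $\alpha$ a stack variable; for a relation $R$, $p\Downarrow_R$ means $p\,R^*\,q$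 with $q$ final. For $i\in\mathbb N$, inductively: $\rightsquigarrow_i=\succ\cup\{(\delta_{v,w}\ast\pi,v\ast\pi)\mid\exists j<i,\ v\not\equiv_jw\}$; $t\equiv_iu$ iff for all $j\le i$, stacks $\pi$, substitutions $\sigma$: $t\sigma\ast\pi\Downarrow_{\rightsquigarrow_j}\Leftrightarrow u\sigma\ast\pi\Downarrow_{\rightsquigarrow_j}$; $\not\equiv_i$ is its negation. $\equiv=\bigcap_i\equiv_i$. -}

module Defs where

open import Data.Nat using (ℕ; zero; suc)
open import Data.Maybe using (Maybe; just; nothing)
open import Data.Product using (Σ; _×_; _,_)
open import Data.Sum using (_⊎_)
open import Data.Empty using (⊥)
open import Relation.Nullary using (¬_)
open import Relation.Binary.PropositionalEquality using (_≡_)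
open import Relation.Binary.Construct.Closure.ReflexiveTransitive using (Star)
open import Function using (id; _∘_)

-- Syntax.
-- λ-variables and stack variables are represented by de Bruijn indices
-- (binders: λ x t, the x_i of case branches bind λ-variables; μ α t
-- binds a stack variable).  Term variables (never bound) are named by ℕ.
--
-- A record {l_i = v_i}_{i∈I} (I finite) is a finite partial map from
-- labels to values; it is encoded canonically (without duplicates and
-- without order) as a list of (gap , value) pairs with strictly
-- increasing labels: the first label is the first gap g₀, and each
-- subsequent label is (previous label) + 1 + gap.  Case branches
-- [C_i[x_i] → t_i]_{i∈I} are encoded the same way (finite partial map
-- from constructors to branch bodies, each body binding one λ-variable).

mutual
  data Value : Set where
    var : ℕ → Value
    lam : Term → Value
    con : ℕ → Value → Value
    rec : Fields → Value

  data Fields : Set where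
    fnil  : Fields
    fcons : ℕ → Value → Fields → Fields

  data Term : Set where
    tvar  : ℕ → Term
    val   : Value → Term
    app   : Term → Term → Term
    mu    : Term → Term
    proc  : Proc → Term
    proj  : Value → ℕ → Term
    case  : Value → Branches → Term
    delta : Value → Value → Term

  data Branches : Set where
    bnil  : Branches
    bcons : ℕ → Term → Branches → Branches

  data Stack : Set where
    svar  : ℕ → Stack
    push  : Value → Stack → Stack
    frame : Term → Stack → Stack

  data Proc : Set where
    _∗_ : Term → Stack → Proc

infix 4 _∗_

lookupF : Fields → ℕ → Maybe Value
lookupF fnil l = nothing
lookupF (fcons zero v fs) zero = just v
lookupF (fcons zero v fs) (suc l) = lookupF fs l
lookupF (fcons (suc g) v fs) zero = nothing
lookupF (fcons (suc g) v fs) (suc l) = lookupF (fcons g v fs) l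

lookupB : Branches → ℕ → Maybe Term
lookupB bnil c = nothing
lookupB (bcons zero t bs) zero = just t
lookupB (bcons zero t bs) (suc c) = lookupB bs c
lookupB (bcons (suc g) t bs) zero = nothing
lookupB (bcons (suc g) t bs) (suc c) = lookupB (bcons g t bs) c

ext : (ℕ → ℕ) → ℕ → ℕ
ext ρ zero = zero
ext ρ (suc n) = suc (ρ n)

mutual
  renV : (ℕ → ℕ) → (ℕ → ℕ) → Value → Value
  renV ρ κ (var x) = var (ρ x)
  renV ρ κ (lam t) = lam (renT (ext ρ) κ t)
  renV ρ κ (con c v) = con c (renV ρ κ v)
  renV ρ κ (rec fs) = rec (renF ρ κ fs)

  renF : (ℕ → ℕ) → (ℕ → ℕ) → Fields → Fields
  renF ρ κ fnil = fnil
  renF ρ κ (fcons g v fs) = fcons g (renV ρ κ v) (renF ρ κ fs)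

  renT : (ℕ → ℕ) → (ℕ → ℕ) → Term → Term
  renT ρ κ (tvar a) = tvar a
  renT ρ κ (val v) = val (renV ρ κ v)
  renT ρ κ (app t u) = app (renT ρ κ t) (renT ρ κ u)
  renT ρ κ (mu t) = mu (renT ρ (ext κ) t)
  renT ρ κ (proc p) = proc (renP ρ κ p)
  renT ρ κ (proj v l) = proj (renV ρ κ v) l
  renT ρ κ (case v bs) = case (renV ρ κ v) (renB ρ κ bs)
  renT ρ κ (delta v w) = delta (renV ρ κ v) (renV ρ κ w)

  renB : (ℕ → ℕ) → (ℕ → ℕ) → Branches → Branches
  renB ρ κ bnil = bnil
  renB ρ κ (bcons g t bs) = bcons g (renT (ext ρ) κ t) (renB ρ κ bs)

  renS : (ℕ → ℕ) → (ℕ → ℕ) → Stack → Stack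
  renS ρ κ (svar α) = svar (κ α)
  renS ρ κ (push v π) = push (renV ρ κ v) (renS ρ κ π)
  renS ρ κ (frame t π) = frame (renT ρ κ t) (renS ρ κ π)

  renP : (ℕ → ℕ) → (ℕ → ℕ) → Proc → Proc
  renP ρ κ (t ∗ π) = renT ρ κ t ∗ renS ρ κ π

record Subst : Set where
  field
    onλ : ℕ → Value
    onα : ℕ → Stack
    ona : ℕ → Term
open Subst public

liftλ : Subst → Subst
onλ (liftλ σ) zero = var zero
onλ (liftλ σ) (suc n) = renV suc id (onλ σ n)
onα (liftλ σ) n = renS suc id (onα σ n)
ona (liftλ σ) n = renT suc id (ona σ n)

liftα : Subst → Subst
onλ (liftα σ) n = renV id suc (onλ σ n)
onα (liftα σ) zero = svar zero
onα (liftα σ) (suc n) = renS id suc (onα σ n)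
ona (liftα σ) n = renT id suc (ona σ n)

mutual
  subV : Subst → Value → Value
  subV σ (var x) = onλ σ x
  subV σ (lam t) = lam (subT (liftλ σ) t)
  subV σ (con c v) = con c (subV σ v)
  subV σ (rec fs) = rec (subF σ fs)

  subF : Subst → Fields → Fields
  subF σ fnil = fnil
  subF σ (fcons g v fs) = fcons g (subV σ v) (subF σ fs)

  subT : Subst → Term → Term
  subT σ (tvar a) = ona σ a
  subT σ (val v) = val (subV σ v)
  subT σ (app t u) = app (subT σ t) (subT σ u)
  subT σ (mu t) = mu (subT (liftα σ) t)
  subT σ (proc p) = proc (subP σ p)
  subT σ (proj v l) = proj (subV σ v) l
  subT σ (case v bs) = case (subV σ v) (subB σ bs)
  subT σ (delta v w) = delta (subV σ v) (subV σ w)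

  subB : Subst → Branches → Branches
  subB σ bnil = bnil
  subB σ (bcons g t bs) = bcons g (subT (liftλ σ) t) (subB σ bs)

  subS : Subst → Stack → Stack
  subS σ (svar α) = onα σ α
  subS σ (push v π) = push (subV σ v) (subS σ π)
  subS σ (frame t π) = frame (subT σ t) (subS σ π)

  subP : Subst → Proc → Proc
  subP σ (t ∗ π) = subT σ t ∗ subS σ π

idSubst : Subst
onλ idSubst = var
onα idSubst = svar
ona idSubst = tvar

bodyλ : Value → Subst
onλ (bodyλ v) zero = v
onλ (bodyλ v) (suc n) = var n
onα (bodyλ v) = svar
ona (bodyλ v) = tvar

bodyα : Stack → Subst
onλ (bodyα π) = var
onα (bodyα π) zero = π
onα (bodyα π) (suc n) = svar n
ona (bodyα π) = tvar

_[_≔_] : Term → ℕ → Value → Term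
E [ x ≔ v ] = subT σ E
  where
  σ : Subst
  onλ σ y with Data.Nat._≟_ x y
  ... | Relation.Nullary.yes _ = v
  ... | Relation.Nullary.no _ = var y
  onα σ = svar
  ona σ = tvar

infix 3 _≻_
data _≻_ : Proc → Proc → Set where
  ≻-app  : ∀ {t u π} → app t u ∗ π ≻ u ∗ frame t π
  ≻-arg  : ∀ {v t π} → val v ∗ frame t π ≻ t ∗ push v π
  ≻-lam  : ∀ {t v π} → val (lam t) ∗ push v π ≻ subT (bodyλ v) t ∗ π
  ≻-mu   : ∀ {t π} → mu t ∗ π ≻ subT (bodyα π) t ∗ π
  ≻-proc : ∀ {p π} → proc p ∗ π ≻ p
  ≻-proj : ∀ {fs l v π} → lookupF fs l ≡ just v → proj (rec fs) l ∗ π ≻ val v ∗ π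
  ≻-case : ∀ {c v bs t π} → lookupB bs c ≡ just t →
           case (con c v) bs ∗ π ≻ subT (bodyλ v) t ∗ π

Final : Proc → Set
Final p = Σ Value λ v → Σ ℕ λ α → p ≡ (val v ∗ svar α)

Converges : (Proc → Proc → Set) → Proc → Set
Converges R p = Σ Proc λ q → Star R p q × Final q

-- The stratified relations ⇝_i and equivalences ≡_i, defined by
-- (structural) recursion on i:
--   p ⇝[ i ] q     :  ⇝_i
--   NotEqBelow i v w :  ∃ j < i. v ≢_j w
--   SameAt j t u   :  ∀ π σ. tσ∗π ⇓_{⇝_j} ⇔ uσ∗π ⇓_{⇝_j}
--   EqUpTo i t u   :  ∀ j ≤ i.
mutual
  _⇝[_]_ : Proc → ℕ → Proc → Set
  p ⇝[ i ] q = (p ≻ q) ⊎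
    (Σ Value λ v → Σ Value λ w → Σ Stack λ π →
       (p ≡ (delta v w ∗ π)) × (q ≡ (val v ∗ π)) × NotEqBelow i v w)

  NotEqBelow : ℕ → Value → Value → Set
  NotEqBelow zero v w = ⊥
  NotEqBelow (suc i) v w = (¬ EqUpTo i (val v) (val w)) ⊎ NotEqBelow i v w

  SameAt : ℕ → Term → Term → Set
  SameAt j t u = (π : Stack) (σ : Subst) →
    (Converges (λ p q → p ⇝[ j ] q) (subT σ t ∗ π) →
     Converges (λ p q → p ⇝[ j ] q) (subT σ u ∗ π)) ×
    (Converges (λ p q → p ⇝[ j ] q) (subT σ u ∗ π) →
     Converges (λ p q → p ⇝[ j ] q) (subT σ t ∗ π))

  EqUpTo : ℕ → Term → Term → Set
  EqUpTo zero t u = SameAt zero t u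
  EqUpTo (suc i) t u = SameAt (suc i) t u × EqUpTo i t u

_≡[_]_ : Term → ℕ → Term → Set
t ≡[ i ] u = EqUpTo i t u

_≃_ : Term → Term → Set
t ≃ u = (i : ℕ) → t ≡[ i ] u

-- Let ~ be the least compatible relation on syntax relating aσ to bσ' whenever
-- a ≃ b and σ, σ' are pointwise related by ~.  It is reflexive, symmetric and
-- stable under renaming and substitution, and it relates E[x:=v] to E[x:=w]
-- when v ≃ w; so it suffices to show that ~ is contained in every ≡_j, i.e.
-- that convergence under ⇝_j transfers along ~.  This goes by induction on j
-- and on the reduction: each step is mirrored by the same step on the other
-- side, except when the inspected value is a hole aσ ~ bσ'.  There one
-- continues with aσ' and finally swaps a for b using a ≡_j b, which is
-- legitimate because every position in which a value is inspected is reached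
-- by a β-step from a value on a stack.  A δ-step needs v ≢_i w ⇒ v' ≢_i w' only
-- for i < j, which is the induction hypothesis on j.

module Submission where

open import Defs
open import Data.Nat using (ℕ; zero; suc; _≟_)
open import Data.Product using (Σ; _×_; _,_; proj₁; proj₂)
open import Data.Sum using (inj₁; inj₂)
open import Data.Empty using (⊥)
open import Data.Unit using (⊤; tt)
open import Data.Maybe using (just)
open import Relation.Nullary using (yes; no)
open import Relation.Binary.PropositionalEquality
  using (_≡_; _≗_; refl; sym; trans; cong; cong₂; subst)
open import Relation.Binary.Construct.Closure.ReflexiveTransitive using (Star; ε; _◅_)
open import Function using (id; _∘_)

ext-square : ∀ {f g f' g'} → f ∘ g ≗ f' ∘ g' → ext f ∘ ext g ≗ ext f' ∘ ext g'
ext-square e zero = refl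
ext-square e (suc n) = cong suc (e n)

mutual
  renV-comm : ∀ {ρ₁ κ₁ ρ₂ κ₂ ρ₁' κ₁' ρ₂' κ₂'} → ρ₂ ∘ ρ₁ ≗ ρ₂' ∘ ρ₁' → κ₂ ∘ κ₁ ≗ κ₂' ∘ κ₁' →
              ∀ v → renV ρ₂ κ₂ (renV ρ₁ κ₁ v) ≡ renV ρ₂' κ₂' (renV ρ₁' κ₁' v)
  renV-comm e f (var x) = cong var (e x)
  renV-comm e f (lam t) = cong lam (renT-comm (ext-square e) f t)
  renV-comm e f (con c v) = cong (con c) (renV-comm e f v)
  renV-comm e f (rec fs) = cong rec (renF-comm e f fs)

  renF-comm : ∀ {ρ₁ κ₁ ρ₂ κ₂ ρ₁' κ₁' ρ₂' κ₂'} → ρ₂ ∘ ρ₁ ≗ ρ₂' ∘ ρ₁' → κ₂ ∘ κ₁ ≗ κ₂' ∘ κ₁' →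
              ∀ fs → renF ρ₂ κ₂ (renF ρ₁ κ₁ fs) ≡ renF ρ₂' κ₂' (renF ρ₁' κ₁' fs)
  renF-comm e f fnil = refl
  renF-comm e f (fcons g v fs) = cong₂ (fcons g) (renV-comm e f v) (renF-comm e f fs)

  renT-comm : ∀ {ρ₁ κ₁ ρ₂ κ₂ ρ₁' κ₁' ρ₂' κ₂'} → ρ₂ ∘ ρ₁ ≗ ρ₂' ∘ ρ₁' → κ₂ ∘ κ₁ ≗ κ₂' ∘ κ₁' →
              ∀ t → renT ρ₂ κ₂ (renT ρ₁ κ₁ t) ≡ renT ρ₂' κ₂' (renT ρ₁' κ₁' t)
  renT-comm e f (tvar a) = refl
  renT-comm e f (val v) = cong val (renV-comm e f v)
  renT-comm e f (app t u) = cong₂ app (renT-comm e f t) (renT-comm e f u)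
  renT-comm e f (mu t) = cong mu (renT-comm e (ext-square f) t)
  renT-comm e f (proc p) = cong proc (renP-comm e f p)
  renT-comm e f (proj v l) = cong (λ v → proj v l) (renV-comm e f v)
  renT-comm e f (case v bs) = cong₂ case (renV-comm e f v) (renB-comm e f bs)
  renT-comm e f (delta v w) = cong₂ delta (renV-comm e f v) (renV-comm e f w)

  renB-comm : ∀ {ρ₁ κ₁ ρ₂ κ₂ ρ₁' κ₁' ρ₂' κ₂'} → ρ₂ ∘ ρ₁ ≗ ρ₂' ∘ ρ₁' → κ₂ ∘ κ₁ ≗ κ₂' ∘ κ₁' →
              ∀ bs → renB ρ₂ κ₂ (renB ρ₁ κ₁ bs) ≡ renB ρ₂' κ₂' (renB ρ₁' κ₁' bs)
  renB-comm e f bnil = refl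
  renB-comm e f (bcons g t bs) = cong₂ (bcons g) (renT-comm (ext-square e) f t) (renB-comm e f bs)

  renS-comm : ∀ {ρ₁ κ₁ ρ₂ κ₂ ρ₁' κ₁' ρ₂' κ₂'} → ρ₂ ∘ ρ₁ ≗ ρ₂' ∘ ρ₁' → κ₂ ∘ κ₁ ≗ κ₂' ∘ κ₁' →
              ∀ π → renS ρ₂ κ₂ (renS ρ₁ κ₁ π) ≡ renS ρ₂' κ₂' (renS ρ₁' κ₁' π)
  renS-comm e f (svar α) = cong svar (f α)
  renS-comm e f (push v π) = cong₂ push (renV-comm e f v) (renS-comm e f π)
  renS-comm e f (frame t π) = cong₂ frame (renT-comm e f t) (renS-comm e f π)

  renP-comm : ∀ {ρ₁ κ₁ ρ₂ κ₂ ρ₁' κ₁' ρ₂' κ₂'} → ρ₂ ∘ ρ₁ ≗ ρ₂' ∘ ρ₁' → κ₂ ∘ κ₁ ≗ κ₂' ∘ κ₁' →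
              ∀ p → renP ρ₂ κ₂ (renP ρ₁ κ₁ p) ≡ renP ρ₂' κ₂' (renP ρ₁' κ₁' p)
  renP-comm e f (t ∗ π) = cong₂ _∗_ (renT-comm e f t) (renS-comm e f π)

infix 4 _≐_
record _≐_ (σ τ : Subst) : Set where
  field
    onλ-≡ : ∀ n → onλ σ n ≡ onλ τ n
    onα-≡ : ∀ n → onα σ n ≡ onα τ n
    ona-≡ : ∀ n → ona σ n ≡ ona τ n
open _≐_

≐-refl : ∀ {σ} → σ ≐ σ
≐-refl = record { onλ-≡ = λ _ → refl ; onα-≡ = λ _ → refl ; ona-≡ = λ _ → refl }

sub∘ren : Subst → (ℕ → ℕ) → (ℕ → ℕ) → Subst
onλ (sub∘ren σ ρ κ) n = onλ σ (ρ n)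
onα (sub∘ren σ ρ κ) n = onα σ (κ n)
ona (sub∘ren σ ρ κ) n = ona σ n

ren∘sub : (ℕ → ℕ) → (ℕ → ℕ) → Subst → Subst
onλ (ren∘sub ρ κ σ) n = renV ρ κ (onλ σ n)
onα (ren∘sub ρ κ σ) n = renS ρ κ (onα σ n)
ona (ren∘sub ρ κ σ) n = renT ρ κ (ona σ n)

infixl 5 _⊙_
_⊙_ : Subst → Subst → Subst
onλ (τ ⊙ σ) n = subV τ (onλ σ n)
onα (τ ⊙ σ) n = subS τ (onα σ n)
ona (τ ⊙ σ) n = subT τ (ona σ n)

sub∘ren-liftλ : ∀ {σ ρ κ τ} → sub∘ren σ ρ κ ≐ τ → sub∘ren (liftλ σ) (ext ρ) κ ≐ liftλ τ
onλ-≡ (sub∘ren-liftλ h) zero = refl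
onλ-≡ (sub∘ren-liftλ h) (suc n) = cong (renV suc id) (onλ-≡ h n)
onα-≡ (sub∘ren-liftλ h) n = cong (renS suc id) (onα-≡ h n)
ona-≡ (sub∘ren-liftλ h) n = cong (renT suc id) (ona-≡ h n)

sub∘ren-liftα : ∀ {σ ρ κ τ} → sub∘ren σ ρ κ ≐ τ → sub∘ren (liftα σ) ρ (ext κ) ≐ liftα τ
onλ-≡ (sub∘ren-liftα h) n = cong (renV id suc) (onλ-≡ h n)
onα-≡ (sub∘ren-liftα h) zero = refl
onα-≡ (sub∘ren-liftα h) (suc n) = cong (renS id suc) (onα-≡ h n)
ona-≡ (sub∘ren-liftα h) n = cong (renT id suc) (ona-≡ h n)

mutual
  subV-renV : ∀ {σ ρ κ τ} → sub∘ren σ ρ κ ≐ τ → ∀ v → subV σ (renV ρ κ v) ≡ subV τ v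
  subV-renV h (var x) = onλ-≡ h x
  subV-renV h (lam t) = cong lam (subT-renT (sub∘ren-liftλ h) t)
  subV-renV h (con c v) = cong (con c) (subV-renV h v)
  subV-renV h (rec fs) = cong rec (subF-renF h fs)

  subF-renF : ∀ {σ ρ κ τ} → sub∘ren σ ρ κ ≐ τ → ∀ fs → subF σ (renF ρ κ fs) ≡ subF τ fs
  subF-renF h fnil = refl
  subF-renF h (fcons g v fs) = cong₂ (fcons g) (subV-renV h v) (subF-renF h fs)

  subT-renT : ∀ {σ ρ κ τ} → sub∘ren σ ρ κ ≐ τ → ∀ t → subT σ (renT ρ κ t) ≡ subT τ t
  subT-renT h (tvar a) = ona-≡ h a
  subT-renT h (val v) = cong val (subV-renV h v)
  subT-renT h (app t u) = cong₂ app (subT-renT h t) (subT-renT h u)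
  subT-renT h (mu t) = cong mu (subT-renT (sub∘ren-liftα h) t)
  subT-renT h (proc p) = cong proc (subP-renP h p)
  subT-renT h (proj v l) = cong (λ v → proj v l) (subV-renV h v)
  subT-renT h (case v bs) = cong₂ case (subV-renV h v) (subB-renB h bs)
  subT-renT h (delta v w) = cong₂ delta (subV-renV h v) (subV-renV h w)

  subB-renB : ∀ {σ ρ κ τ} → sub∘ren σ ρ κ ≐ τ → ∀ bs → subB σ (renB ρ κ bs) ≡ subB τ bs
  subB-renB h bnil = refl
  subB-renB h (bcons g t bs) = cong₂ (bcons g) (subT-renT (sub∘ren-liftλ h) t) (subB-renB h bs)

  subS-renS : ∀ {σ ρ κ τ} → sub∘ren σ ρ κ ≐ τ → ∀ π → subS σ (renS ρ κ π) ≡ subS τ π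
  subS-renS h (svar α) = onα-≡ h α
  subS-renS h (push v π) = cong₂ push (subV-renV h v) (subS-renS h π)
  subS-renS h (frame t π) = cong₂ frame (subT-renT h t) (subS-renS h π)

  subP-renP : ∀ {σ ρ κ τ} → sub∘ren σ ρ κ ≐ τ → ∀ p → subP σ (renP ρ κ p) ≡ subP τ p
  subP-renP h (t ∗ π) = cong₂ _∗_ (subT-renT h t) (subS-renS h π)

ren∘sub-liftλ : ∀ {ρ κ σ τ} → ren∘sub ρ κ σ ≐ τ → ren∘sub (ext ρ) κ (liftλ σ) ≐ liftλ τ
onλ-≡ (ren∘sub-liftλ h) zero = refl
onλ-≡ (ren∘sub-liftλ {σ = σ} h) (suc n) =
  trans (renV-comm (λ _ → refl) (λ _ → refl) (onλ σ n)) (cong (renV suc id) (onλ-≡ h n))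
onα-≡ (ren∘sub-liftλ {σ = σ} h) n =
  trans (renS-comm (λ _ → refl) (λ _ → refl) (onα σ n)) (cong (renS suc id) (onα-≡ h n))
ona-≡ (ren∘sub-liftλ {σ = σ} h) n =
  trans (renT-comm (λ _ → refl) (λ _ → refl) (ona σ n)) (cong (renT suc id) (ona-≡ h n))

ren∘sub-liftα : ∀ {ρ κ σ τ} → ren∘sub ρ κ σ ≐ τ → ren∘sub ρ (ext κ) (liftα σ) ≐ liftα τ
onλ-≡ (ren∘sub-liftα {σ = σ} h) n =
  trans (renV-comm (λ _ → refl) (λ _ → refl) (onλ σ n)) (cong (renV id suc) (onλ-≡ h n))
onα-≡ (ren∘sub-liftα h) zero = refl
onα-≡ (ren∘sub-liftα {σ = σ} h) (suc n) =
  trans (renS-comm (λ _ → refl) (λ _ → refl) (onα σ n)) (cong (renS id suc) (onα-≡ h n))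
ona-≡ (ren∘sub-liftα {σ = σ} h) n =
  trans (renT-comm (λ _ → refl) (λ _ → refl) (ona σ n)) (cong (renT id suc) (ona-≡ h n))

mutual
  renV-subV : ∀ {ρ κ σ τ} → ren∘sub ρ κ σ ≐ τ → ∀ v → renV ρ κ (subV σ v) ≡ subV τ v
  renV-subV h (var x) = onλ-≡ h x
  renV-subV h (lam t) = cong lam (renT-subT (ren∘sub-liftλ h) t)
  renV-subV h (con c v) = cong (con c) (renV-subV h v)
  renV-subV h (rec fs) = cong rec (renF-subF h fs)

  renF-subF : ∀ {ρ κ σ τ} → ren∘sub ρ κ σ ≐ τ → ∀ fs → renF ρ κ (subF σ fs) ≡ subF τ fs
  renF-subF h fnil = refl
  renF-subF h (fcons g v fs) = cong₂ (fcons g) (renV-subV h v) (renF-subF h fs)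

  renT-subT : ∀ {ρ κ σ τ} → ren∘sub ρ κ σ ≐ τ → ∀ t → renT ρ κ (subT σ t) ≡ subT τ t
  renT-subT h (tvar a) = ona-≡ h a
  renT-subT h (val v) = cong val (renV-subV h v)
  renT-subT h (app t u) = cong₂ app (renT-subT h t) (renT-subT h u)
  renT-subT h (mu t) = cong mu (renT-subT (ren∘sub-liftα h) t)
  renT-subT h (proc p) = cong proc (renP-subP h p)
  renT-subT h (proj v l) = cong (λ v → proj v l) (renV-subV h v)
  renT-subT h (case v bs) = cong₂ case (renV-subV h v) (renB-subB h bs)
  renT-subT h (delta v w) = cong₂ delta (renV-subV h v) (renV-subV h w)

  renB-subB : ∀ {ρ κ σ τ} → ren∘sub ρ κ σ ≐ τ → ∀ bs → renB ρ κ (subB σ bs) ≡ subB τ bs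
  renB-subB h bnil = refl
  renB-subB h (bcons g t bs) = cong₂ (bcons g) (renT-subT (ren∘sub-liftλ h) t) (renB-subB h bs)

  renS-subS : ∀ {ρ κ σ τ} → ren∘sub ρ κ σ ≐ τ → ∀ π → renS ρ κ (subS σ π) ≡ subS τ π
  renS-subS h (svar α) = onα-≡ h α
  renS-subS h (push v π) = cong₂ push (renV-subV h v) (renS-subS h π)
  renS-subS h (frame t π) = cong₂ frame (renT-subT h t) (renS-subS h π)

  renP-subP : ∀ {ρ κ σ τ} → ren∘sub ρ κ σ ≐ τ → ∀ p → renP ρ κ (subP σ p) ≡ subP τ p
  renP-subP h (t ∗ π) = cong₂ _∗_ (renT-subT h t) (renS-subS h π)

-- sub∘ren (liftλ τ) suc id and ren∘sub suc id τ agree definitionally, so both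
-- fusion lemmas apply with ≐-refl.
⊙-liftλ : ∀ {τ σ υ} → τ ⊙ σ ≐ υ → liftλ τ ⊙ liftλ σ ≐ liftλ υ
onλ-≡ (⊙-liftλ h) zero = refl
onλ-≡ (⊙-liftλ {τ} {σ} h) (suc n) =
  trans (subV-renV ≐-refl (onλ σ n)) (trans (sym (renV-subV ≐-refl (onλ σ n))) (cong (renV suc id) (onλ-≡ h n)))
onα-≡ (⊙-liftλ {τ} {σ} h) n =
  trans (subS-renS ≐-refl (onα σ n)) (trans (sym (renS-subS ≐-refl (onα σ n))) (cong (renS suc id) (onα-≡ h n)))
ona-≡ (⊙-liftλ {τ} {σ} h) n =
  trans (subT-renT ≐-refl (ona σ n)) (trans (sym (renT-subT ≐-refl (ona σ n))) (cong (renT suc id) (ona-≡ h n)))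

⊙-liftα : ∀ {τ σ υ} → τ ⊙ σ ≐ υ → liftα τ ⊙ liftα σ ≐ liftα υ
onλ-≡ (⊙-liftα {τ} {σ} h) n =
  trans (subV-renV ≐-refl (onλ σ n)) (trans (sym (renV-subV ≐-refl (onλ σ n))) (cong (renV id suc) (onλ-≡ h n)))
onα-≡ (⊙-liftα h) zero = refl
onα-≡ (⊙-liftα {τ} {σ} h) (suc n) =
  trans (subS-renS ≐-refl (onα σ n)) (trans (sym (renS-subS ≐-refl (onα σ n))) (cong (renS id suc) (onα-≡ h n)))
ona-≡ (⊙-liftα {τ} {σ} h) n =
  trans (subT-renT ≐-refl (ona σ n)) (trans (sym (renT-subT ≐-refl (ona σ n))) (cong (renT id suc) (ona-≡ h n)))

mutual
  subV-subV : ∀ {τ σ υ} → τ ⊙ σ ≐ υ → ∀ v → subV τ (subV σ v) ≡ subV υ v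
  subV-subV h (var x) = onλ-≡ h x
  subV-subV h (lam t) = cong lam (subT-subT (⊙-liftλ h) t)
  subV-subV h (con c v) = cong (con c) (subV-subV h v)
  subV-subV h (rec fs) = cong rec (subF-subF h fs)

  subF-subF : ∀ {τ σ υ} → τ ⊙ σ ≐ υ → ∀ fs → subF τ (subF σ fs) ≡ subF υ fs
  subF-subF h fnil = refl
  subF-subF h (fcons g v fs) = cong₂ (fcons g) (subV-subV h v) (subF-subF h fs)

  subT-subT : ∀ {τ σ υ} → τ ⊙ σ ≐ υ → ∀ t → subT τ (subT σ t) ≡ subT υ t
  subT-subT h (tvar a) = ona-≡ h a
  subT-subT h (val v) = cong val (subV-subV h v)
  subT-subT h (app t u) = cong₂ app (subT-subT h t) (subT-subT h u)
  subT-subT h (mu t) = cong mu (subT-subT (⊙-liftα h) t)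
  subT-subT h (proc p) = cong proc (subP-subP h p)
  subT-subT h (proj v l) = cong (λ v → proj v l) (subV-subV h v)
  subT-subT h (case v bs) = cong₂ case (subV-subV h v) (subB-subB h bs)
  subT-subT h (delta v w) = cong₂ delta (subV-subV h v) (subV-subV h w)

  subB-subB : ∀ {τ σ υ} → τ ⊙ σ ≐ υ → ∀ bs → subB τ (subB σ bs) ≡ subB υ bs
  subB-subB h bnil = refl
  subB-subB h (bcons g t bs) = cong₂ (bcons g) (subT-subT (⊙-liftλ h) t) (subB-subB h bs)

  subS-subS : ∀ {τ σ υ} → τ ⊙ σ ≐ υ → ∀ π → subS τ (subS σ π) ≡ subS υ π
  subS-subS h (svar α) = onα-≡ h α
  subS-subS h (push v π) = cong₂ push (subV-subV h v) (subS-subS h π)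
  subS-subS h (frame t π) = cong₂ frame (subT-subT h t) (subS-subS h π)

  subP-subP : ∀ {τ σ υ} → τ ⊙ σ ≐ υ → ∀ p → subP τ (subP σ p) ≡ subP υ p
  subP-subP h (t ∗ π) = cong₂ _∗_ (subT-subT h t) (subS-subS h π)

≐id-liftλ : ∀ {σ} → σ ≐ idSubst → liftλ σ ≐ idSubst
onλ-≡ (≐id-liftλ h) zero = refl
onλ-≡ (≐id-liftλ h) (suc n) = cong (renV suc id) (onλ-≡ h n)
onα-≡ (≐id-liftλ h) n = cong (renS suc id) (onα-≡ h n)
ona-≡ (≐id-liftλ h) n = cong (renT suc id) (ona-≡ h n)

≐id-liftα : ∀ {σ} → σ ≐ idSubst → liftα σ ≐ idSubst
onλ-≡ (≐id-liftα h) n = cong (renV id suc) (onλ-≡ h n)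
onα-≡ (≐id-liftα h) zero = refl
onα-≡ (≐id-liftα h) (suc n) = cong (renS id suc) (onα-≡ h n)
ona-≡ (≐id-liftα h) n = cong (renT id suc) (ona-≡ h n)

mutual
  subV-id : ∀ {σ} → σ ≐ idSubst → ∀ v → subV σ v ≡ v
  subV-id h (var x) = onλ-≡ h x
  subV-id h (lam t) = cong lam (subT-id (≐id-liftλ h) t)
  subV-id h (con c v) = cong (con c) (subV-id h v)
  subV-id h (rec fs) = cong rec (subF-id h fs)

  subF-id : ∀ {σ} → σ ≐ idSubst → ∀ fs → subF σ fs ≡ fs
  subF-id h fnil = refl
  subF-id h (fcons g v fs) = cong₂ (fcons g) (subV-id h v) (subF-id h fs)

  subT-id : ∀ {σ} → σ ≐ idSubst → ∀ t → subT σ t ≡ t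
  subT-id h (tvar a) = ona-≡ h a
  subT-id h (val v) = cong val (subV-id h v)
  subT-id h (app t u) = cong₂ app (subT-id h t) (subT-id h u)
  subT-id h (mu t) = cong mu (subT-id (≐id-liftα h) t)
  subT-id h (proc p) = cong proc (subP-id h p)
  subT-id h (proj v l) = cong (λ v → proj v l) (subV-id h v)
  subT-id h (case v bs) = cong₂ case (subV-id h v) (subB-id h bs)
  subT-id h (delta v w) = cong₂ delta (subV-id h v) (subV-id h w)

  subB-id : ∀ {σ} → σ ≐ idSubst → ∀ bs → subB σ bs ≡ bs
  subB-id h bnil = refl
  subB-id h (bcons g t bs) = cong₂ (bcons g) (subT-id (≐id-liftλ h) t) (subB-id h bs)

  subS-id : ∀ {σ} → σ ≐ idSubst → ∀ π → subS σ π ≡ π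
  subS-id h (svar α) = onα-≡ h α
  subS-id h (push v π) = cong₂ push (subV-id h v) (subS-id h π)
  subS-id h (frame t π) = cong₂ frame (subT-id h t) (subS-id h π)

  subP-id : ∀ {σ} → σ ≐ idSubst → ∀ p → subP σ p ≡ p
  subP-id h (t ∗ π) = cong₂ _∗_ (subT-id h t) (subS-id h π)

subB-bodyλ-weaken : ∀ v bs → subB (bodyλ v) (renB suc id bs) ≡ bs
subB-bodyλ-weaken v bs = trans (subB-renB ≐-refl bs) (subB-id ≐-refl bs)

SameAt-sym : ∀ j {t u} → SameAt j t u → SameAt j u t
SameAt-sym j h π σ = proj₂ (h π σ) , proj₁ (h π σ)

SameAt-trans : ∀ j {t u s} → SameAt j t u → SameAt j u s → SameAt j t s
SameAt-trans j h k π σ = (proj₁ (k π σ) ∘ proj₁ (h π σ)) , (proj₂ (h π σ) ∘ proj₂ (k π σ))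

≡[]-sym : ∀ i {t u} → t ≡[ i ] u → u ≡[ i ] t
≡[]-sym zero {t} {u} h = SameAt-sym zero {t} {u} h
≡[]-sym (suc i) {t} {u} (h , r) = SameAt-sym (suc i) {t} {u} h , ≡[]-sym i {t} {u} r

≡[]-trans : ∀ i {t u s} → t ≡[ i ] u → u ≡[ i ] s → t ≡[ i ] s
≡[]-trans zero {t} {u} {s} h k = SameAt-trans zero {t} {u} {s} h k
≡[]-trans (suc i) {t} {u} {s} (h , h') (k , k') =
  SameAt-trans (suc i) {t} {u} {s} h k , ≡[]-trans i {t} {u} {s} h' k'

≡[]⇒SameAt : ∀ i {t u} → t ≡[ i ] u → SameAt i t u
≡[]⇒SameAt zero h = h
≡[]⇒SameAt (suc i) (h , _) = h

≃-sym : ∀ {t u} → t ≃ u → u ≃ t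
≃-sym {t} {u} h i = ≡[]-sym i {t} {u} (h i)

-- The equations in ~hole keep its indices as variables, so that it can be
-- matched against the other constructors.
mutual
  infix 4 _~ᵛ_ _~ᶠ_ _~ᵗ_ _~ᵇ_ _~ˢ_ _~ᵖ_ _~σ_

  data _~ᵛ_ : Value → Value → Set where
    ~var  : ∀ n → var n ~ᵛ var n
    ~lam  : ∀ {t t'} → t ~ᵗ t' → lam t ~ᵛ lam t'
    ~con  : ∀ c {v v'} → v ~ᵛ v' → con c v ~ᵛ con c v'
    ~rec  : ∀ {fs fs'} → fs ~ᶠ fs' → rec fs ~ᵛ rec fs'
    ~hole : ∀ {a b σ σ' A B} → val a ≃ val b → σ ~σ σ' →
            A ≡ subV σ a → B ≡ subV σ' b → A ~ᵛ B

  data _~σ_ (σ σ' : Subst) : Set where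
    pointwise : (∀ n → onλ σ n ~ᵛ onλ σ' n) → (∀ n → onα σ n ~ˢ onα σ' n) →
                (∀ n → ona σ n ~ᵗ ona σ' n) → σ ~σ σ'

  data _~ᶠ_ : Fields → Fields → Set where
    ~fnil  : fnil ~ᶠ fnil
    ~fcons : ∀ g {v v' fs fs'} → v ~ᵛ v' → fs ~ᶠ fs' → fcons g v fs ~ᶠ fcons g v' fs'

  data _~ᵗ_ : Term → Term → Set where
    ~tvar  : ∀ a → tvar a ~ᵗ tvar a
    ~val   : ∀ {v v'} → v ~ᵛ v' → val v ~ᵗ val v'
    ~app   : ∀ {t t' u u'} → t ~ᵗ t' → u ~ᵗ u' → app t u ~ᵗ app t' u'
    ~mu    : ∀ {t t'} → t ~ᵗ t' → mu t ~ᵗ mu t'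
    ~proc  : ∀ {p p'} → p ~ᵖ p' → proc p ~ᵗ proc p'
    ~proj  : ∀ {v v'} → v ~ᵛ v' → ∀ l → proj v l ~ᵗ proj v' l
    ~case  : ∀ {v v' bs bs'} → v ~ᵛ v' → bs ~ᵇ bs' → case v bs ~ᵗ case v' bs'
    ~delta : ∀ {v v' w w'} → v ~ᵛ v' → w ~ᵛ w' → delta v w ~ᵗ delta v' w'

  data _~ᵇ_ : Branches → Branches → Set where
    ~bnil  : bnil ~ᵇ bnil
    ~bcons : ∀ g {t t' bs bs'} → t ~ᵗ t' → bs ~ᵇ bs' → bcons g t bs ~ᵇ bcons g t' bs'

  data _~ˢ_ : Stack → Stack → Set where
    ~svar  : ∀ α → svar α ~ˢ svar α
    ~push  : ∀ {v v' π π'} → v ~ᵛ v' → π ~ˢ π' → push v π ~ˢ push v' π'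
    ~frame : ∀ {t t' π π'} → t ~ᵗ t' → π ~ˢ π' → frame t π ~ˢ frame t' π'

  data _~ᵖ_ : Proc → Proc → Set where
    ~∗ : ∀ {t t' π π'} → t ~ᵗ t' → π ~ˢ π' → (t ∗ π) ~ᵖ (t' ∗ π')

mutual
  ~ᵛ-refl : ∀ v → v ~ᵛ v
  ~ᵛ-refl (var x) = ~var x
  ~ᵛ-refl (lam t) = ~lam (~ᵗ-refl t)
  ~ᵛ-refl (con c v) = ~con c (~ᵛ-refl v)
  ~ᵛ-refl (rec fs) = ~rec (~ᶠ-refl fs)

  ~ᶠ-refl : ∀ fs → fs ~ᶠ fs
  ~ᶠ-refl fnil = ~fnil
  ~ᶠ-refl (fcons g v fs) = ~fcons g (~ᵛ-refl v) (~ᶠ-refl fs)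

  ~ᵗ-refl : ∀ t → t ~ᵗ t
  ~ᵗ-refl (tvar a) = ~tvar a
  ~ᵗ-refl (val v) = ~val (~ᵛ-refl v)
  ~ᵗ-refl (app t u) = ~app (~ᵗ-refl t) (~ᵗ-refl u)
  ~ᵗ-refl (mu t) = ~mu (~ᵗ-refl t)
  ~ᵗ-refl (proc p) = ~proc (~ᵖ-refl p)
  ~ᵗ-refl (proj v l) = ~proj (~ᵛ-refl v) l
  ~ᵗ-refl (case v bs) = ~case (~ᵛ-refl v) (~ᵇ-refl bs)
  ~ᵗ-refl (delta v w) = ~delta (~ᵛ-refl v) (~ᵛ-refl w)

  ~ᵇ-refl : ∀ bs → bs ~ᵇ bs
  ~ᵇ-refl bnil = ~bnil
  ~ᵇ-refl (bcons g t bs) = ~bcons g (~ᵗ-refl t) (~ᵇ-refl bs)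

  ~ˢ-refl : ∀ π → π ~ˢ π
  ~ˢ-refl (svar α) = ~svar α
  ~ˢ-refl (push v π) = ~push (~ᵛ-refl v) (~ˢ-refl π)
  ~ˢ-refl (frame t π) = ~frame (~ᵗ-refl t) (~ˢ-refl π)

  ~ᵖ-refl : ∀ p → p ~ᵖ p
  ~ᵖ-refl (t ∗ π) = ~∗ (~ᵗ-refl t) (~ˢ-refl π)

~σ-refl : ∀ σ → σ ~σ σ
~σ-refl σ = pointwise (~ᵛ-refl ∘ onλ σ) (~ˢ-refl ∘ onα σ) (~ᵗ-refl ∘ ona σ)

mutual
  ~ᵛ-sym : ∀ {v v'} → v ~ᵛ v' → v' ~ᵛ v
  ~ᵛ-sym (~var n) = ~var n
  ~ᵛ-sym (~lam e) = ~lam (~ᵗ-sym e)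
  ~ᵛ-sym (~con c e) = ~con c (~ᵛ-sym e)
  ~ᵛ-sym (~rec e) = ~rec (~ᶠ-sym e)
  ~ᵛ-sym (~hole h s eA eB) = ~hole (≃-sym h) (~σ-sym s) eB eA

  ~σ-sym : ∀ {σ σ'} → σ ~σ σ' → σ' ~σ σ
  ~σ-sym (pointwise f g k) = pointwise (~ᵛ-sym ∘ f) (~ˢ-sym ∘ g) (~ᵗ-sym ∘ k)

  ~ᶠ-sym : ∀ {fs fs'} → fs ~ᶠ fs' → fs' ~ᶠ fs
  ~ᶠ-sym ~fnil = ~fnil
  ~ᶠ-sym (~fcons g e r) = ~fcons g (~ᵛ-sym e) (~ᶠ-sym r)

  ~ᵗ-sym : ∀ {t t'} → t ~ᵗ t' → t' ~ᵗ t
  ~ᵗ-sym (~tvar a) = ~tvar a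
  ~ᵗ-sym (~val e) = ~val (~ᵛ-sym e)
  ~ᵗ-sym (~app e f) = ~app (~ᵗ-sym e) (~ᵗ-sym f)
  ~ᵗ-sym (~mu e) = ~mu (~ᵗ-sym e)
  ~ᵗ-sym (~proc e) = ~proc (~ᵖ-sym e)
  ~ᵗ-sym (~proj e l) = ~proj (~ᵛ-sym e) l
  ~ᵗ-sym (~case e f) = ~case (~ᵛ-sym e) (~ᵇ-sym f)
  ~ᵗ-sym (~delta e f) = ~delta (~ᵛ-sym e) (~ᵛ-sym f)

  ~ᵇ-sym : ∀ {bs bs'} → bs ~ᵇ bs' → bs' ~ᵇ bs
  ~ᵇ-sym ~bnil = ~bnil
  ~ᵇ-sym (~bcons g e r) = ~bcons g (~ᵗ-sym e) (~ᵇ-sym r)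

  ~ˢ-sym : ∀ {π π'} → π ~ˢ π' → π' ~ˢ π
  ~ˢ-sym (~svar α) = ~svar α
  ~ˢ-sym (~push e r) = ~push (~ᵛ-sym e) (~ˢ-sym r)
  ~ˢ-sym (~frame e r) = ~frame (~ᵗ-sym e) (~ˢ-sym r)

  ~ᵖ-sym : ∀ {p p'} → p ~ᵖ p' → p' ~ᵖ p
  ~ᵖ-sym (~∗ e f) = ~∗ (~ᵗ-sym e) (~ˢ-sym f)

mutual
  renV-~ : ∀ ρ κ {v v'} → v ~ᵛ v' → renV ρ κ v ~ᵛ renV ρ κ v'
  renV-~ ρ κ (~var n) = ~var (ρ n)
  renV-~ ρ κ (~lam e) = ~lam (renT-~ (ext ρ) κ e)
  renV-~ ρ κ (~con c e) = ~con c (renV-~ ρ κ e)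
  renV-~ ρ κ (~rec e) = ~rec (renF-~ ρ κ e)
  renV-~ ρ κ (~hole {a} {b} h (pointwise f g k) refl refl) =
    ~hole h (pointwise (renV-~ ρ κ ∘ f) (renS-~ ρ κ ∘ g) (renT-~ ρ κ ∘ k))
      (renV-subV ≐-refl a) (renV-subV ≐-refl b)

  renF-~ : ∀ ρ κ {fs fs'} → fs ~ᶠ fs' → renF ρ κ fs ~ᶠ renF ρ κ fs'
  renF-~ ρ κ ~fnil = ~fnil
  renF-~ ρ κ (~fcons g e r) = ~fcons g (renV-~ ρ κ e) (renF-~ ρ κ r)

  renT-~ : ∀ ρ κ {t t'} → t ~ᵗ t' → renT ρ κ t ~ᵗ renT ρ κ t'
  renT-~ ρ κ (~tvar a) = ~tvar a
  renT-~ ρ κ (~val e) = ~val (renV-~ ρ κ e)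
  renT-~ ρ κ (~app e f) = ~app (renT-~ ρ κ e) (renT-~ ρ κ f)
  renT-~ ρ κ (~mu e) = ~mu (renT-~ ρ (ext κ) e)
  renT-~ ρ κ (~proc e) = ~proc (renP-~ ρ κ e)
  renT-~ ρ κ (~proj e l) = ~proj (renV-~ ρ κ e) l
  renT-~ ρ κ (~case e f) = ~case (renV-~ ρ κ e) (renB-~ ρ κ f)
  renT-~ ρ κ (~delta e f) = ~delta (renV-~ ρ κ e) (renV-~ ρ κ f)

  renB-~ : ∀ ρ κ {bs bs'} → bs ~ᵇ bs' → renB ρ κ bs ~ᵇ renB ρ κ bs'
  renB-~ ρ κ ~bnil = ~bnil
  renB-~ ρ κ (~bcons g e r) = ~bcons g (renT-~ (ext ρ) κ e) (renB-~ ρ κ r)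

  renS-~ : ∀ ρ κ {π π'} → π ~ˢ π' → renS ρ κ π ~ˢ renS ρ κ π'
  renS-~ ρ κ (~svar α) = ~svar (κ α)
  renS-~ ρ κ (~push e r) = ~push (renV-~ ρ κ e) (renS-~ ρ κ r)
  renS-~ ρ κ (~frame e r) = ~frame (renT-~ ρ κ e) (renS-~ ρ κ r)

  renP-~ : ∀ ρ κ {p p'} → p ~ᵖ p' → renP ρ κ p ~ᵖ renP ρ κ p'
  renP-~ ρ κ (~∗ e f) = ~∗ (renT-~ ρ κ e) (renS-~ ρ κ f)

liftλ-~ : ∀ {σ σ'} → σ ~σ σ' → liftλ σ ~σ liftλ σ'
liftλ-~ (pointwise f g k) =
  pointwise (λ { zero → ~var zero ; (suc n) → renV-~ suc id (f n) })
            (renS-~ suc id ∘ g) (renT-~ suc id ∘ k)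

liftα-~ : ∀ {σ σ'} → σ ~σ σ' → liftα σ ~σ liftα σ'
liftα-~ (pointwise f g k) =
  pointwise (renV-~ id suc ∘ f)
            (λ { zero → ~svar zero ; (suc n) → renS-~ id suc (g n) }) (renT-~ id suc ∘ k)

mutual
  subV-~ : ∀ {τ τ'} → τ ~σ τ' → ∀ {v v'} → v ~ᵛ v' → subV τ v ~ᵛ subV τ' v'
  subV-~ (pointwise f g k) (~var n) = f n
  subV-~ s (~lam e) = ~lam (subT-~ (liftλ-~ s) e)
  subV-~ s (~con c e) = ~con c (subV-~ s e)
  subV-~ s (~rec e) = ~rec (subF-~ s e)
  subV-~ s (~hole {a} {b} h (pointwise f g k) refl refl) =
    ~hole h (pointwise (subV-~ s ∘ f) (subS-~ s ∘ g) (subT-~ s ∘ k))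
      (subV-subV ≐-refl a) (subV-subV ≐-refl b)

  subF-~ : ∀ {τ τ'} → τ ~σ τ' → ∀ {fs fs'} → fs ~ᶠ fs' → subF τ fs ~ᶠ subF τ' fs'
  subF-~ s ~fnil = ~fnil
  subF-~ s (~fcons g e r) = ~fcons g (subV-~ s e) (subF-~ s r)

  subT-~ : ∀ {τ τ'} → τ ~σ τ' → ∀ {t t'} → t ~ᵗ t' → subT τ t ~ᵗ subT τ' t'
  subT-~ (pointwise f g k) (~tvar a) = k a
  subT-~ s (~val e) = ~val (subV-~ s e)
  subT-~ s (~app e f) = ~app (subT-~ s e) (subT-~ s f)
  subT-~ s (~mu e) = ~mu (subT-~ (liftα-~ s) e)
  subT-~ s (~proc e) = ~proc (subP-~ s e)
  subT-~ s (~proj e l) = ~proj (subV-~ s e) l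
  subT-~ s (~case e f) = ~case (subV-~ s e) (subB-~ s f)
  subT-~ s (~delta e f) = ~delta (subV-~ s e) (subV-~ s f)

  subB-~ : ∀ {τ τ'} → τ ~σ τ' → ∀ {bs bs'} → bs ~ᵇ bs' → subB τ bs ~ᵇ subB τ' bs'
  subB-~ s ~bnil = ~bnil
  subB-~ s (~bcons g e r) = ~bcons g (subT-~ (liftλ-~ s) e) (subB-~ s r)

  subS-~ : ∀ {τ τ'} → τ ~σ τ' → ∀ {π π'} → π ~ˢ π' → subS τ π ~ˢ subS τ' π'
  subS-~ (pointwise f g k) (~svar α) = g α
  subS-~ s (~push e r) = ~push (subV-~ s e) (subS-~ s r)
  subS-~ s (~frame e r) = ~frame (subT-~ s e) (subS-~ s r)

  subP-~ : ∀ {τ τ'} → τ ~σ τ' → ∀ {p p'} → p ~ᵖ p' → subP τ p ~ᵖ subP τ' p'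
  subP-~ s (~∗ e f) = ~∗ (subT-~ s e) (subS-~ s f)

bodyλ-~ : ∀ {v v'} → v ~ᵛ v' → bodyλ v ~σ bodyλ v'
bodyλ-~ e = pointwise (λ { zero → e ; (suc n) → ~var n }) ~svar ~tvar

bodyα-~ : ∀ {π π'} → π ~ˢ π' → bodyα π ~σ bodyα π'
bodyα-~ e = pointwise ~var (λ { zero → e ; (suc n) → ~svar n }) ~tvar

lookupF-~ : ∀ {fs fs'} → fs ~ᶠ fs' → ∀ l {v} → lookupF fs l ≡ just v →
            Σ Value λ v' → lookupF fs' l ≡ just v' × v ~ᵛ v'
lookupF-~ (~fcons zero e r) zero refl = _ , refl , e
lookupF-~ (~fcons zero e r) (suc l) eq = lookupF-~ r l eq
lookupF-~ (~fcons (suc g) e r) (suc l) eq = lookupF-~ (~fcons g e r) l eq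

lookupB-~ : ∀ {bs bs'} → bs ~ᵇ bs' → ∀ c {t} → lookupB bs c ≡ just t →
            Σ Term λ t' → lookupB bs' c ≡ just t' × t ~ᵗ t'
lookupB-~ (~bcons zero e r) zero refl = _ , refl , e
lookupB-~ (~bcons zero e r) (suc c) eq = lookupB-~ r c eq
lookupB-~ (~bcons (suc g) e r) (suc c) eq = lookupB-~ (~bcons g e r) c eq

infix 3 _⇓[_]
_⇓[_] : Proc → ℕ → Set
p ⇓[ j ] = Converges (_⇝[ j ]_) p

⇓-step : ∀ {j p q} → p ⇝[ j ] q → q ⇓[ j ] → p ⇓[ j ]
⇓-step s (r , st , fin) = r , s ◅ st , fin

Final-~ : ∀ {p p'} → p ~ᵖ p' → Final p → Final p'
Final-~ (~∗ (~val {v' = v'} d) (~svar α)) (_ , _ , refl) = v' , α , refl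

redex-⇓ : ∀ {j v t π} → subT (bodyλ v) t ∗ π ⇓[ j ] → val v ∗ frame (val (lam t)) π ⇓[ j ]
redex-⇓ = ⇓-step (inj₁ ≻-arg) ∘ ⇓-step (inj₁ ≻-lam)

redex-⇓⁻¹ : ∀ {j v t π} → val v ∗ frame (val (lam t)) π ⇓[ j ] → subT (bodyλ v) t ∗ π ⇓[ j ]
redex-⇓⁻¹ (_ , inj₁ ≻-arg ◅ inj₁ ≻-lam ◅ st , fin) = _ , st , fin
redex-⇓⁻¹ (_ , ε , (_ , _ , ()))
redex-⇓⁻¹ (_ , inj₂ (_ , _ , _ , () , _) ◅ _ , _)
redex-⇓⁻¹ (_ , inj₁ ≻-arg ◅ ε , (_ , _ , ()))
redex-⇓⁻¹ (_ , inj₁ ≻-arg ◅ inj₂ (_ , _ , _ , () , _) ◅ _ , _)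

-- The three positions in which a reduction rule inspects the shape of a value.
data ValueCtx : Set where
  stackCtx : Stack → ValueCtx
  projCtx  : ℕ → Stack → ValueCtx
  caseCtx  : Branches → Stack → ValueCtx

plug : ValueCtx → Value → Proc
plug (stackCtx π) v = val v ∗ π
plug (projCtx l π) v = proj v l ∗ π
plug (caseCtx bs π) v = case v bs ∗ π

infix 4 _~ᶜ_
data _~ᶜ_ : ValueCtx → ValueCtx → Set where
  ~stackCtx : ∀ {π π'} → π ~ˢ π' → stackCtx π ~ᶜ stackCtx π'
  ~projCtx  : ∀ l {π π'} → π ~ˢ π' → projCtx l π ~ᶜ projCtx l π'
  ~caseCtx  : ∀ {bs bs' π π'} → bs ~ᵇ bs' → π ~ˢ π' → caseCtx bs π ~ᶜ caseCtx bs' π'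

-- plug c v is two steps (≻-arg, ≻-lam) after v ∗ [λx. probe c] (stackOf c).
probe : ValueCtx → Term
probe (stackCtx π) = val (var zero)
probe (projCtx l π) = proj (var zero) l
probe (caseCtx bs π) = case (var zero) (renB suc id bs)

stackOf : ValueCtx → Stack
stackOf (stackCtx π) = π
stackOf (projCtx l π) = π
stackOf (caseCtx bs π) = π

probe-β : ∀ c v → (subT (bodyλ v) (probe c) ∗ stackOf c) ≡ plug c v
probe-β (stackCtx π) v = refl
probe-β (projCtx l π) v = refl
probe-β (caseCtx bs π) v = cong (λ bs' → case v bs' ∗ π) (subB-bodyλ-weaken v bs)

SameAt-plug : ∀ j {a b} → SameAt j (val a) (val b) → ∀ σ c →
              plug c (subV σ a) ⇓[ j ] → plug c (subV σ b) ⇓[ j ]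
SameAt-plug j h σ c =
  subst (_⇓[ j ]) (probe-β c _) ∘ redex-⇓⁻¹ ∘
  proj₁ (h (frame (val (lam (probe c))) (stackOf c)) σ) ∘
  redex-⇓ ∘ subst (_⇓[ j ]) (sym (probe-β c _))

NotHole : ∀ {A B} → A ~ᵛ B → Set
NotHole (~hole _ _ _ _) = ⊥
NotHole _ = ⊤

mutual
  simulate : ∀ j {p p' q} → p ~ᵖ p' → Star (_⇝[ j ]_) p q → Final q → p' ⇓[ j ]
  simulate j e ε fin = _ , ε , Final-~ e fin
  simulate j (~∗ (~val d) r) st fin = simulate-at j d (~stackCtx r) st fin
  simulate j (~∗ (~proj d l) r) st fin = simulate-at j d (~projCtx l r) st fin
  simulate j (~∗ (~case d sb) r) st fin = simulate-at j d (~caseCtx sb r) st fin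
  simulate j (~∗ (~app e f) r) (inj₁ ≻-app ◅ st) fin =
    ⇓-step (inj₁ ≻-app) (simulate j (~∗ f (~frame e r)) st fin)
  simulate j (~∗ (~mu e) r) (inj₁ ≻-mu ◅ st) fin =
    ⇓-step (inj₁ ≻-mu) (simulate j (~∗ (subT-~ (bodyα-~ r) e) r) st fin)
  simulate j (~∗ (~proc e) r) (inj₁ ≻-proc ◅ st) fin =
    ⇓-step (inj₁ ≻-proc) (simulate j e st fin)
  simulate j (~∗ (~delta d₁ d₂) r) (inj₂ (_ , _ , _ , refl , refl , v≢w) ◅ st) fin =
    ⇓-step (inj₂ (_ , _ , _ , refl , refl , NotEqBelow-~ j d₁ d₂ v≢w))
           (simulate j (~∗ (~val d₁) r) st fin)
  simulate j (~∗ (~tvar a) r) (inj₁ () ◅ st) fin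
  simulate j (~∗ (~delta _ _) r) (inj₁ () ◅ st) fin
  simulate j (~∗ (~tvar a) r) (inj₂ (_ , _ , _ , () , _) ◅ st) fin
  simulate j (~∗ (~app _ _) r) (inj₂ (_ , _ , _ , () , _) ◅ st) fin
  simulate j (~∗ (~mu _) r) (inj₂ (_ , _ , _ , () , _) ◅ st) fin
  simulate j (~∗ (~proc _) r) (inj₂ (_ , _ , _ , () , _) ◅ st) fin

  -- For a hole aσ ~ bσ': first move from aσ to aσ' (the variables of a carry
  -- smaller derivations), then swap a for b.
  simulate-at : ∀ j {c c' A B q} → A ~ᵛ B → c ~ᶜ c' → Star (_⇝[ j ]_) (plug c A) q → Final q →
                plug c' B ⇓[ j ]
  simulate-at j (~hole {a} {b} {σ} {σ'} h s refl refl) sc st fin =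
    SameAt-plug j {a} {b} (≡[]⇒SameAt j (h j)) σ' _ (simulate-subV j a s sc st fin)
  simulate-at j d@(~var _) = simulate-head j d tt
  simulate-at j d@(~lam _) = simulate-head j d tt
  simulate-at j d@(~con _ _) = simulate-head j d tt
  simulate-at j d@(~rec _) = simulate-head j d tt

  simulate-subV : ∀ j {c c' σ σ' q} a → σ ~σ σ' → c ~ᶜ c' →
                  Star (_⇝[ j ]_) (plug c (subV σ a)) q → Final q → plug c' (subV σ' a) ⇓[ j ]
  simulate-subV j (var y) (pointwise f _ _) = simulate-at j (f y)
  simulate-subV j (lam t) s = simulate-head j (~lam (subT-~ (liftλ-~ s) (~ᵗ-refl t))) tt
  simulate-subV j (con c v) s = simulate-head j (~con c (subV-~ s (~ᵛ-refl v))) tt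
  simulate-subV j (rec fs) s = simulate-head j (~rec (subF-~ s (~ᶠ-refl fs))) tt

  simulate-head : ∀ j {c c' A B q} (d : A ~ᵛ B) → NotHole d → c ~ᶜ c' →
                  Star (_⇝[ j ]_) (plug c A) q → Final q → plug c' B ⇓[ j ]
  simulate-head j (~hole _ _ _ _) ()
  simulate-head j d _ (~stackCtx r) ε fin = _ , ε , Final-~ (~∗ (~val d) r) fin
  simulate-head j d _ (~stackCtx (~frame e r)) (inj₁ ≻-arg ◅ st) fin =
    ⇓-step (inj₁ ≻-arg) (simulate j (~∗ e (~push d r)) st fin)
  simulate-head j (~lam e) _ (~stackCtx (~push d r)) (inj₁ ≻-lam ◅ st) fin =
    ⇓-step (inj₁ ≻-lam) (simulate j (~∗ (subT-~ (bodyλ-~ d) e) r) st fin)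
  simulate-head j (~rec ef) _ (~projCtx l r) (inj₁ (≻-proj eq) ◅ st) fin
    with lookupF-~ ef l eq
  ... | _ , eq' , d = ⇓-step (inj₁ (≻-proj eq')) (simulate j (~∗ (~val d) r) st fin)
  simulate-head j (~con c d) _ (~caseCtx sb r) (inj₁ (≻-case eq) ◅ st) fin
    with lookupB-~ sb c eq
  ... | _ , eq' , e = ⇓-step (inj₁ (≻-case eq')) (simulate j (~∗ (subT-~ (bodyλ-~ d) e) r) st fin)
  simulate-head j d _ (~projCtx l r) ε (_ , _ , ())
  simulate-head j d _ (~caseCtx sb r) ε (_ , _ , ())
  simulate-head j d _ (~stackCtx r) (inj₂ (_ , _ , _ , () , _) ◅ _) _
  simulate-head j d _ (~projCtx l r) (inj₂ (_ , _ , _ , () , _) ◅ _) _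
  simulate-head j d _ (~caseCtx sb r) (inj₂ (_ , _ , _ , () , _) ◅ _) _
  simulate-head j (~var _) _ (~stackCtx (~push _ _)) (inj₁ () ◅ _) _
  simulate-head j (~con _ _) _ (~stackCtx (~push _ _)) (inj₁ () ◅ _) _
  simulate-head j (~rec _) _ (~stackCtx (~push _ _)) (inj₁ () ◅ _) _
  simulate-head j d _ (~stackCtx (~svar _)) (inj₁ () ◅ _) _
  simulate-head j (~var _) _ (~projCtx l r) (inj₁ () ◅ _) _
  simulate-head j (~lam _) _ (~projCtx l r) (inj₁ () ◅ _) _
  simulate-head j (~con _ _) _ (~projCtx l r) (inj₁ () ◅ _) _
  simulate-head j (~var _) _ (~caseCtx sb r) (inj₁ () ◅ _) _
  simulate-head j (~lam _) _ (~caseCtx sb r) (inj₁ () ◅ _) _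
  simulate-head j (~rec _) _ (~caseCtx sb r) (inj₁ () ◅ _) _

  -- ⇝_j consults ≢_i only for i < j, so only ~ ⊆ ≡_i at lower levels is used.
  NotEqBelow-~ : ∀ i {v₁ v₂ w₁ w₂} → v₁ ~ᵛ w₁ → v₂ ~ᵛ w₂ → NotEqBelow i v₁ v₂ → NotEqBelow i w₁ w₂
  NotEqBelow-~ (suc i) {v₁} {v₂} {w₁} {w₂} d₁ d₂ (inj₁ v₁≢v₂) =
    inj₁ λ w₁≡w₂ → v₁≢v₂ (≡[]-trans i {val v₁} {val w₁} {val v₂} (~⇒≡[ i ] (~val d₁))
                          (≡[]-trans i {val w₁} {val w₂} {val v₂} w₁≡w₂ (~⇒≡[ i ] (~val (~ᵛ-sym d₂)))))
  NotEqBelow-~ (suc i) d₁ d₂ (inj₂ r) = inj₂ (NotEqBelow-~ i d₁ d₂ r)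

  ~⇒SameAt : ∀ j {t t'} → t ~ᵗ t' → SameAt j t t'
  ~⇒SameAt j e π σ = (λ (_ , st , fin) → simulate j (~∗ (subT-~ (~σ-refl σ) e) (~ˢ-refl π)) st fin)
                   , (λ (_ , st , fin) → simulate j (~∗ (subT-~ (~σ-refl σ) (~ᵗ-sym e)) (~ˢ-refl π)) st fin)

  ~⇒≡[_] : ∀ i {t t'} → t ~ᵗ t' → t ≡[ i ] t'
  ~⇒≡[ zero ] e = ~⇒SameAt zero e
  ~⇒≡[ suc i ] e = ~⇒SameAt (suc i) e , ~⇒≡[ i ] e

≃⇒~ᵛ : ∀ {v w} → val v ≃ val w → v ~ᵛ w
≃⇒~ᵛ {v} {w} h = ~hole h (~σ-refl idSubst) (sym (subV-id ≐-refl v)) (sym (subV-id ≐-refl w))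

~val⁻¹ : ∀ {v w} → val v ~ᵗ val w → v ~ᵛ w
~val⁻¹ (~val d) = d

[≔]-~ : ∀ E x {v w} → v ~ᵛ w → (E [ x ≔ v ]) ~ᵗ (E [ x ≔ w ])
[≔]-~ E x {v} {w} d = subT-~ (pointwise (~val⁻¹ ∘ var-[≔]-~) ~svar ~tvar) (~ᵗ-refl E)
  where
  -- The substitution behind _[_≔_] is local to Defs; val (var y) [ x ≔ v ] exposes its value at y.
  var-[≔]-~ : ∀ y → (val (var y) [ x ≔ v ]) ~ᵗ (val (var y) [ x ≔ w ])
  var-[≔]-~ y with x ≟ y
  ... | yes _ = ~val d
  ... | no _ = ~val (~var y)

theorem2 : (v w : Value) (E : Term) (x : ℕ) →
    val v ≃ val w → (E [ x ≔ v ]) ≃ (E [ x ≔ w ])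
theorem2 v w E x v≃w i = ~⇒≡[ i ] ([≔]-~ E x (≃⇒~ᵛ v≃w))
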